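{- Let $t\geq 1$ and $k=2t+1$, and let $F$ be an isolation matrix in $A_{k,t}$. Then every row and every column of $F$ contains at most three zeros.
   Context: $[k]=\{1,\dots,k\}$ and $A_{k,t}$ is the Boolean matrix with rows and columns indexed by all $t$-subsets of $[k]$, with entry $1$ at $(x,y)$ iff $x\cap y\neq\emptyset$. An isolation matrix in $A_{k,t}$ is a square submatrix $F$ of $A_{k,t}$ (given by a list of distinct row indices $x_1,\dots,x_n$ and a list of distinct column indices $y_1,\dots,y_n$, $F[i][j]=A_{k,t}[x_i][y_j]$) whose diagonal entries are all $1$ and such that for $i\neq j$, $F[i][j]=0$ or $F[j][i]=0$. -}

module Defs where

open import Data.Nat using (ℕ; _≤_)
open import Data.Bool using (Bool; true; false; not; _∧_; _∨_)
open import Data.Fin using (Fin)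
open import Data.Fin.Subset using (Subset; ∣_∣)
open import Data.Vec using (Vec; []; _∷_; countᵇ; allFin)
open import Data.Product using (_×_; Σ; _,_)
open import Data.Sum using (_⊎_)
open import Function.Definitions using (Injective)
open import Relation.Binary.PropositionalEquality using (_≡_)
open import Relation.Nullary using (¬_)

TSubset : ℕ → ℕ → Set
TSubset k t = Σ (Subset k) (λ x → ∣ x ∣ ≡ t)

meets : ∀ {k} → Subset k → Subset k → Bool
meets []       []       = false
meets (a ∷ x)  (b ∷ y)  = (a ∧ b) ∨ meets x y

-- The entry of A_{k,t} at (x , y): true (= 1) iff x ∩ y ≠ ∅.
A : (k t : ℕ) → TSubset k t → TSubset k t → Bool
A k t (x , _) (y , _) = meets x y

record IsolationMatrix (k t n : ℕ) : Set where
  field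
    xs     : Fin n → TSubset k t
    ys     : Fin n → TSubset k t
    xs-inj : Injective _≡_ _≡_ xs
    ys-inj : Injective _≡_ _≡_ ys

  entry : Fin n → Fin n → Bool
  entry i j = A k t (xs i) (ys j)

  field
    diag  : ∀ i → entry i i ≡ true
    isol  : ∀ i j → ¬ (i ≡ j) → (entry i j ≡ false) ⊎ (entry j i ≡ false)

  rowZeros : Fin n → ℕ
  rowZeros i = countᵇ (λ j → not (entry i j)) (allFin n)

  colZeros : Fin n → ℕ
  colZeros j = countᵇ (λ i → not (entry i j)) (allFin n)

-- Fix a row x of F and let a, b, c index zero columns of that row. If row a had
-- zeros in both columns b ≠ c, then x, y_b, x_a ∩ y_a and y_c ─ y_b would be
-- pairwise disjoint subsets of [2t+1] of sizes t, t, ≥ 1, ≥ 1, which is too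
-- many elements. So on the zero columns of a row, the isolation property gives
-- a tournament in which every vertex has out-degree at most one; such a
-- tournament has at most three vertices. Columns follow by transposing F.
module Submission where

open import Defs
open import Data.Bool using (Bool; true; false; not; if_then_else_)
open import Data.Bool.Properties using (∨-conicalˡ; ∨-conicalʳ; ∧-comm; not-injective)
open import Data.Empty using (⊥)
open import Data.Fin using (Fin; zero; suc)
open import Data.Fin.Patterns using (0F; 1F; 2F; 3F)
import Data.Fin.Properties as Finₚ
open import Data.Fin.Subset using (Subset; ∣_∣; _∩_; _∪_; _─_; _⊆_)
open import Data.Fin.Subset.Properties
  using (drop-∷-⊆; out⊆; s⊆s; p⊆q⇒∣p∣≤∣q∣; ∣p∣≤n; p∩q⊆p; p∩q⊆q; p─q⊆p)
import Data.Vec.Functional as Vector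
open import Data.Nat using (ℕ; zero; suc; _+_; _*_; _≤_; _<_; z≤n; s≤s)
open import Data.Nat.Properties
  using (≡-irrelevant; suc-injective; +-suc; +-mono-≤; +-monoʳ-≤; 1+n≰n; module ≤-Reasoning)
open import Data.Nat.Tactic.RingSolver using (solve-∀)
open import Data.Product using (_×_; _,_; proj₁; proj₂)
open import Data.Sum using (_⊎_; inj₁; inj₂)
import Data.Sum as Sum
open import Data.Vec using (Vec; []; _∷_; here; countᵇ; allFin; map)
open import Data.Vec.Properties using (tabulate-allFin)
open import Function using (_∘_; id)
open import Function.Definitions using (Injective)
open import Relation.Binary.Core using (Rel)
open import Level using (0ℓ)
open import Relation.Nullary using (contradiction)
open import Relation.Binary.PropositionalEquality
  using (_≡_; _≢_; refl; sym; trans; cong; cong₂; subst; _≗_)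

private
  variable
    k m n : ℕ

Disjoint : Subset k → Subset k → Set
Disjoint p q = meets p q ≡ false

meets-sym : (p q : Subset k) → meets p q ≡ meets q p
meets-sym []      []      = refl
meets-sym (a ∷ p) (b ∷ q) rewrite meets-sym p q | ∧-comm a b = refl

Disjoint-sym : (p q : Subset k) → Disjoint p q → Disjoint q p
Disjoint-sym p q d = trans (meets-sym q p) d

Disjoint-⊆ˡ : (p q r : Subset k) → p ⊆ q → Disjoint q r → Disjoint p r
Disjoint-⊆ˡ []          []          []      _   _ = refl
Disjoint-⊆ˡ (false ∷ p) (_ ∷ q)     (_ ∷ r) p⊆q d = Disjoint-⊆ˡ p q r (drop-∷-⊆ p⊆q) (∨-conicalʳ _ _ d)
Disjoint-⊆ˡ (true ∷ p)  (true ∷ q)  (c ∷ r) p⊆q d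
  rewrite ∨-conicalˡ c _ d = Disjoint-⊆ˡ p q r (drop-∷-⊆ p⊆q) (∨-conicalʳ _ _ d)
Disjoint-⊆ˡ (true ∷ p)  (false ∷ q) _       p⊆q _ with p⊆q here
... | ()

Disjoint-⊆ʳ : (p q r : Subset k) → q ⊆ r → Disjoint p r → Disjoint p q
Disjoint-⊆ʳ p q r q⊆r d = Disjoint-sym q p (Disjoint-⊆ˡ q r p q⊆r (Disjoint-sym p r d))

Disjoint-─ : (p q : Subset k) → Disjoint (p ─ q) q
Disjoint-─ []          []          = refl
Disjoint-─ (_ ∷ p)     (true ∷ q)  = Disjoint-─ p q
Disjoint-─ (true ∷ p)  (false ∷ q) = Disjoint-─ p q
Disjoint-─ (false ∷ p) (false ∷ q) = Disjoint-─ p q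

Disjoint-∪ˡ : (p q r : Subset k) → Disjoint p r → Disjoint q r → Disjoint (p ∪ q) r
Disjoint-∪ˡ []          []          []      _ _  = refl
Disjoint-∪ˡ (true ∷ p)  (_ ∷ q)     (c ∷ r) d d′
  rewrite ∨-conicalˡ c _ d  = Disjoint-∪ˡ p q r (∨-conicalʳ _ _ d) (∨-conicalʳ _ _ d′)
Disjoint-∪ˡ (false ∷ p) (true ∷ q)  (c ∷ r) d d′
  rewrite ∨-conicalˡ c _ d′ = Disjoint-∪ˡ p q r d (∨-conicalʳ _ _ d′)
Disjoint-∪ˡ (false ∷ p) (false ∷ q) (_ ∷ r) d d′ = Disjoint-∪ˡ p q r d d′

∣p∪q∣≡∣p∣+∣q∣ : (p q : Subset k) → Disjoint p q → ∣ p ∪ q ∣ ≡ ∣ p ∣ + ∣ q ∣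
∣p∪q∣≡∣p∣+∣q∣ []          []          _ = refl
∣p∪q∣≡∣p∣+∣q∣ (true ∷ p)  (false ∷ q) d = cong suc (∣p∪q∣≡∣p∣+∣q∣ p q d)
∣p∪q∣≡∣p∣+∣q∣ (false ∷ p) (true ∷ q)  d =
  trans (cong suc (∣p∪q∣≡∣p∣+∣q∣ p q d)) (sym (+-suc ∣ p ∣ ∣ q ∣))
∣p∪q∣≡∣p∣+∣q∣ (false ∷ p) (false ∷ q) d = ∣p∪q∣≡∣p∣+∣q∣ p q d

∣p∣+∣q∣+∣r∣+∣s∣≤n : (p q r s : Subset k) →
  Disjoint p q → Disjoint p r → Disjoint p s → Disjoint q r → Disjoint q s → Disjoint r s →
  ∣ p ∣ + ∣ q ∣ + ∣ r ∣ + ∣ s ∣ ≤ k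
∣p∣+∣q∣+∣r∣+∣s∣≤n {k = k} p q r s pq pr ps qr qs rs = begin
  ∣ p ∣ + ∣ q ∣ + ∣ r ∣ + ∣ s ∣ ≡⟨ cong (λ m → m + ∣ r ∣ + ∣ s ∣) (∣p∪q∣≡∣p∣+∣q∣ p q pq) ⟨
  ∣ p ∪ q ∣ + ∣ r ∣ + ∣ s ∣     ≡⟨ cong (_+ ∣ s ∣) (∣p∪q∣≡∣p∣+∣q∣ (p ∪ q) r pq∪r) ⟨
  ∣ (p ∪ q) ∪ r ∣ + ∣ s ∣       ≡⟨ ∣p∪q∣≡∣p∣+∣q∣ ((p ∪ q) ∪ r) s pqr∪s ⟨
  ∣ ((p ∪ q) ∪ r) ∪ s ∣         ≤⟨ ∣p∣≤n (((p ∪ q) ∪ r) ∪ s) ⟩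
  k                             ∎
  where
  open ≤-Reasoning
  pq∪r : Disjoint (p ∪ q) r
  pq∪r = Disjoint-∪ˡ p q r pr qr
  pqr∪s : Disjoint ((p ∪ q) ∪ r) s
  pqr∪s = Disjoint-∪ˡ (p ∪ q) r s (Disjoint-∪ˡ p q s ps qs) rs

meets⇒0<∣p∩q∣ : (p q : Subset k) → meets p q ≡ true → 0 < ∣ p ∩ q ∣
meets⇒0<∣p∩q∣ []          []          ()
meets⇒0<∣p∩q∣ (true ∷ p)  (true ∷ q)  _ = s≤s z≤n
meets⇒0<∣p∩q∣ (true ∷ p)  (false ∷ q) e = meets⇒0<∣p∩q∣ p q e
meets⇒0<∣p∩q∣ (false ∷ p) (_ ∷ q)     e = meets⇒0<∣p∩q∣ p q e

∣p─q∣≡0⇒p⊆q : (p q : Subset k) → ∣ p ─ q ∣ ≡ 0 → p ⊆ q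
∣p─q∣≡0⇒p⊆q []          []          _ = λ ()
∣p─q∣≡0⇒p⊆q (true ∷ p)  (true ∷ q)  e = s⊆s (∣p─q∣≡0⇒p⊆q p q e)
∣p─q∣≡0⇒p⊆q (true ∷ p)  (false ∷ q) ()
∣p─q∣≡0⇒p⊆q (false ∷ p) (true ∷ q)  e = out⊆ (∣p─q∣≡0⇒p⊆q p q e)
∣p─q∣≡0⇒p⊆q (false ∷ p) (false ∷ q) e = out⊆ (∣p─q∣≡0⇒p⊆q p q e)

p⊆q⇒∣p∣≡∣q∣⇒p≡q : (p q : Subset k) → p ⊆ q → ∣ p ∣ ≡ ∣ q ∣ → p ≡ q
p⊆q⇒∣p∣≡∣q∣⇒p≡q []          []          _   _ = refl
p⊆q⇒∣p∣≡∣q∣⇒p≡q (true ∷ p)  (true ∷ q)  p⊆q e =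
  cong (true ∷_) (p⊆q⇒∣p∣≡∣q∣⇒p≡q p q (drop-∷-⊆ p⊆q) (suc-injective e))
p⊆q⇒∣p∣≡∣q∣⇒p≡q (true ∷ p)  (false ∷ q) p⊆q _ with p⊆q here
... | ()
p⊆q⇒∣p∣≡∣q∣⇒p≡q (false ∷ p) (true ∷ q)  p⊆q e =
  contradiction (subst (_≤ ∣ q ∣) e (p⊆q⇒∣p∣≤∣q∣ (drop-∷-⊆ p⊆q))) 1+n≰n
p⊆q⇒∣p∣≡∣q∣⇒p≡q (false ∷ p) (false ∷ q) p⊆q e =
  cong (false ∷_) (p⊆q⇒∣p∣≡∣q∣⇒p≡q p q (drop-∷-⊆ p⊆q) e)

p≢q⇒0<∣p─q∣ : (p q : Subset k) → ∣ p ∣ ≡ ∣ q ∣ → p ≢ q → 0 < ∣ p ─ q ∣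
p≢q⇒0<∣p─q∣ p q ∣p∣≡∣q∣ p≢q with ∣ p ─ q ∣ in ∣p─q∣≡
... | zero  = contradiction (p⊆q⇒∣p∣≡∣q∣⇒p≡q p q (∣p─q∣≡0⇒p⊆q p q ∣p─q∣≡) ∣p∣≡∣q∣) p≢q
... | suc _ = s≤s z≤n

no-zero-pattern : ∀ {t} (x x′ y′ y z : Subset (suc (2 * t))) →
  ∣ x ∣ ≡ t → ∣ y ∣ ≡ t → ∣ z ∣ ≡ t → y ≢ z →
  meets x′ y′ ≡ true → Disjoint x y′ → Disjoint x y → Disjoint x z → Disjoint x′ y → Disjoint x′ z → ⊥
no-zero-pattern {t} x x′ y′ y z ∣x∣≡t ∣y∣≡t ∣z∣≡t y≢z x′∩y′≢∅ x∩y′≡∅ x∩y≡∅ x∩z≡∅ x′∩y≡∅ x′∩z≡∅ =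
  1+n≰n (begin
    suc (suc (2 * t))                          ≡⟨ double+2 t ⟩
    t + t + 1 + 1                              ≤⟨ +-mono-≤ (+-monoʳ-≤ (t + t) (meets⇒0<∣p∩q∣ x′ y′ x′∩y′≢∅))
                                                           (p≢q⇒0<∣p─q∣ z y (trans ∣z∣≡t (sym ∣y∣≡t)) (y≢z ∘ sym)) ⟩
    t + t + ∣ x′ ∩ y′ ∣ + ∣ z ─ y ∣            ≡⟨ cong₂ (λ a b → a + b + ∣ x′ ∩ y′ ∣ + ∣ z ─ y ∣) ∣x∣≡t ∣y∣≡t ⟨
    ∣ x ∣ + ∣ y ∣ + ∣ x′ ∩ y′ ∣ + ∣ z ─ y ∣    ≤⟨ ∣p∣+∣q∣+∣r∣+∣s∣≤n x y (x′ ∩ y′) (z ─ y)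
                                                    x∩y≡∅ x-x′∩y′ x-z─y y-x′∩y′ y-z─y x′∩y′-z─y ⟩
    suc (2 * t)                                ∎)
  where
  open ≤-Reasoning
  double+2 : ∀ t → suc (suc (2 * t)) ≡ t + t + 1 + 1
  double+2 = solve-∀
  x-x′∩y′ : Disjoint x (x′ ∩ y′)
  x-x′∩y′ = Disjoint-⊆ʳ x (x′ ∩ y′) y′ (p∩q⊆q x′ y′) x∩y′≡∅
  x-z─y : Disjoint x (z ─ y)
  x-z─y = Disjoint-⊆ʳ x (z ─ y) z (p─q⊆p z y) x∩z≡∅
  y-x′∩y′ : Disjoint y (x′ ∩ y′)
  y-x′∩y′ = Disjoint-⊆ʳ y (x′ ∩ y′) x′ (p∩q⊆p x′ y′) (Disjoint-sym x′ y x′∩y≡∅)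
  y-z─y : Disjoint y (z ─ y)
  y-z─y = Disjoint-sym (z ─ y) y (Disjoint-─ z y)
  x′∩y′-z─y : Disjoint (x′ ∩ y′) (z ─ y)
  x′∩y′-z─y = Disjoint-⊆ˡ (x′ ∩ y′) x′ (z ─ y) (p∩q⊆p x′ y′)
                (Disjoint-⊆ʳ x′ (z ─ y) z (p─q⊆p z y) x′∩z≡∅)

Tournament : ∀ {V : Set} {ℓ} → Rel V ℓ → Set ℓ
Tournament {V = V} E = ∀ (i j : V) → i ≢ j → E i j ⊎ E j i

OutdegreeAtMostOne : ∀ {V : Set} {ℓ} → Rel V ℓ → Set ℓ
OutdegreeAtMostOne {V = V} E = ∀ {i j l : V} → j ≢ l → E i j → E i l → ⊥

no-two-in-neighbours : ∀ {V : Set} {ℓ} (E : Rel V ℓ) → Tournament E → OutdegreeAtMostOne E →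
  ∀ {i j l} → i ≢ j → i ≢ l → j ≢ l → E i l → E j l → ⊥
no-two-in-neighbours E total outdegree≤1 i≢j i≢l j≢l i→l j→l with total _ _ i≢j
... | inj₁ i→j = outdegree≤1 j≢l i→j i→l
... | inj₂ j→i = outdegree≤1 i≢l j→i j→l

-- Vertex 0 has at most one out-neighbour among 1, 2, 3, so two of them point to 0.
no-tournament₄-with-outdegree≤1 : ∀ {ℓ} (E : Rel (Fin 4) ℓ) → Tournament E → OutdegreeAtMostOne E → ⊥
no-tournament₄-with-outdegree≤1 E total outdegree≤1
  with total 0F 1F (λ ()) | total 0F 2F (λ ()) | total 0F 3F (λ ())
... | inj₁ 0→1 | inj₁ 0→2 | _        = outdegree≤1 (λ ()) 0→1 0→2
... | inj₁ 0→1 | inj₂ _   | inj₁ 0→3 = outdegree≤1 (λ ()) 0→1 0→3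
... | inj₁ _   | inj₂ 2→0 | inj₂ 3→0 = no-two-in-neighbours E total outdegree≤1 (λ ()) (λ ()) (λ ()) 2→0 3→0
... | inj₂ _   | inj₁ 0→2 | inj₁ 0→3 = outdegree≤1 (λ ()) 0→2 0→3
... | inj₂ 1→0 | inj₁ _   | inj₂ 3→0 = no-two-in-neighbours E total outdegree≤1 (λ ()) (λ ()) (λ ()) 1→0 3→0
... | inj₂ 1→0 | inj₂ 2→0 | _        = no-two-in-neighbours E total outdegree≤1 (λ ()) (λ ()) (λ ()) 1→0 2→0

countᵇ-map : ∀ {A B : Set} (Q : B → Bool) (f : A → B) (xs : Vec A n) →
  countᵇ Q (map f xs) ≡ countᵇ (Q ∘ f) xs
countᵇ-map Q f []       = refl
countᵇ-map Q f (x ∷ xs) with Q (f x)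
... | true  = cong suc (countᵇ-map Q f xs)
... | false = countᵇ-map Q f xs

0∷suc∘-injective : (v : Fin m → Fin n) → Injective _≡_ _≡_ v →
  Injective _≡_ _≡_ (zero Vector.∷ (suc ∘ v))
0∷suc∘-injective v v-inj {zero}  {zero}  _ = refl
0∷suc∘-injective v v-inj {suc i} {suc j} e = cong suc (v-inj (Finₚ.suc-injective e))

countᵇ-allFin-suc : (Q : Fin (suc n) → Bool) →
  countᵇ Q (allFin (suc n)) ≡ (if Q zero then suc else id) (countᵇ (Q ∘ suc) (allFin n))
countᵇ-allFin-suc {n = n} Q =
  cong (if Q zero then suc else id)
    (trans (cong (countᵇ Q) (tabulate-allFin suc)) (countᵇ-map Q suc (allFin n)))

countᵇ-allFin≤ : ∀ m (Q : Fin n → Bool) →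
  (∀ (v : Fin (suc m) → Fin n) → Injective _≡_ _≡_ v → (∀ i → Q (v i) ≡ true) → ⊥) →
  countᵇ Q (allFin n) ≤ m
countᵇ-allFin≤ {n = zero}  m Q _ = z≤n
countᵇ-allFin≤ {n = suc n} m Q no-injection
  rewrite countᵇ-allFin-suc Q with Q zero in Q0≡true
countᵇ-allFin≤ {n = suc n} zero    Q no-injection | true =
  contradiction (λ { zero → Q0≡true }) (no-injection (λ _ → zero) λ { {zero} {zero} _ → refl })
countᵇ-allFin≤ {n = suc n} (suc m) Q no-injection | true = s≤s (countᵇ-allFin≤ m (Q ∘ suc)
  λ v v-inj Qv → no-injection (zero Vector.∷ (suc ∘ v)) (0∷suc∘-injective v v-inj)
    λ { zero → Q0≡true ; (suc i) → Qv i })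
countᵇ-allFin≤ {n = suc n} m Q no-injection | false = countᵇ-allFin≤ m (Q ∘ suc)
  λ v v-inj → no-injection (suc ∘ v) (v-inj ∘ Finₚ.suc-injective)

countᵇ-cong : ∀ {A : Set} {P Q : A → Bool} → P ≗ Q → (xs : Vec A n) → countᵇ P xs ≡ countᵇ Q xs
countᵇ-cong P≗Q []                 = refl
countᵇ-cong {Q = Q} P≗Q (x ∷ xs) rewrite P≗Q x = cong (if Q x then suc else id) (countᵇ-cong P≗Q xs)

TSubset-≡ : ∀ {t} (x y : TSubset k t) → proj₁ x ≡ proj₁ y → x ≡ y
TSubset-≡ (p , ∣p∣≡t) (.p , ∣p∣≡t′) refl = cong (p ,_) (≡-irrelevant ∣p∣≡t ∣p∣≡t′)

transpose : ∀ {t} → IsolationMatrix k t n → IsolationMatrix k t n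
transpose F = record
  { xs     = ys
  ; ys     = xs
  ; xs-inj = ys-inj
  ; ys-inj = xs-inj
  ; diag   = λ i → trans (entry≡transposed i i) (diag i)
  ; isol   = λ i j i≢j →
      Sum.map (trans (entry≡transposed j i)) (trans (entry≡transposed i j)) (isol j i (i≢j ∘ sym))
  }
  where
  open IsolationMatrix F
  entry≡transposed : ∀ i j → meets (proj₁ (ys j)) (proj₁ (xs i)) ≡ entry i j
  entry≡transposed i j = meets-sym (proj₁ (ys j)) (proj₁ (xs i))

colZeros≡rowZeros-transpose : ∀ {t} (F : IsolationMatrix k t n) j →
  IsolationMatrix.colZeros F j ≡ IsolationMatrix.rowZeros (transpose F) j
colZeros≡rowZeros-transpose F j =
  countᵇ-cong (λ i → cong not (meets-sym (proj₁ (xs i)) (proj₁ (ys j)))) (allFin _)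
  where open IsolationMatrix F

rowZeros≤3 : ∀ {t} (F : IsolationMatrix (suc (2 * t)) t n) i → IsolationMatrix.rowZeros F i ≤ 3
rowZeros≤3 {n = n} F i = countᵇ-allFin≤ 3 _ no-four-zeros
  where
  open IsolationMatrix F
  X Y : Fin n → Subset _
  X = proj₁ ∘ xs
  Y = proj₁ ∘ ys
  no-four-zeros : (v : Fin 4 → Fin n) → Injective _≡_ _≡_ v → (∀ l → not (entry i (v l)) ≡ true) → ⊥
  no-four-zeros v v-inj zero-at = no-tournament₄-with-outdegree≤1 E total outdegree≤1
    where
    E : Rel (Fin 4) 0ℓ
    E l l′ = entry (v l) (v l′) ≡ false
    row-i-zero-at : ∀ l → Disjoint (X i) (Y (v l))
    row-i-zero-at l = not-injective (zero-at l)
    total : Tournament E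
    total l l′ l≢l′ = isol (v l) (v l′) (l≢l′ ∘ v-inj)
    outdegree≤1 : OutdegreeAtMostOne E
    outdegree≤1 {l} {j} {j′} j≢j′ =
      no-zero-pattern (X i) (X (v l)) (Y (v l)) (Y (v j)) (Y (v j′))
        (proj₂ (xs i)) (proj₂ (ys (v j))) (proj₂ (ys (v j′)))
        (j≢j′ ∘ v-inj ∘ ys-inj ∘ TSubset-≡ (ys (v j)) (ys (v j′))) (diag (v l))
        (row-i-zero-at l) (row-i-zero-at j) (row-i-zero-at j′)

claim6 : (t : ℕ) → 1 ≤ t → (n : ℕ) → (F : IsolationMatrix (suc (2 * t)) t n) →
    (∀ i → IsolationMatrix.rowZeros F i ≤ 3) × (∀ j → IsolationMatrix.colZeros F j ≤ 3)
claim6 t _ n F = rowZeros≤3 F , colZeros≤3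
  where
  colZeros≤3 : ∀ j → IsolationMatrix.colZeros F j ≤ 3
  colZeros≤3 j = subst (_≤ 3) (sym (colZeros≡rowZeros-transpose F j)) (rowZeros≤3 (transpose F) j)
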